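{- For every integer $n\ge 6$, the complement $\overline{W_n}$ of the wheel graph $W_n$ contains $K_{\lfloor 3(n-1)/4\rfloor}$ as a minor.
   Context: For $n\ge 4$, the wheel graph $W_n$ on $n$ vertices is the join $K_1+C_{n-1}$: a cycle on $n-1$ vertices together with one additional vertex adjacent to all vertices of the cycle. The complement $\overline{G}$ has the same vertex set as $G$, with two distinct vertices adjacent iff they are not adjacent in $G$. Minors are obtained by vertex deletions, edge deletions and edge contractions. -}

module Defs where

open import Data.Nat using (ℕ; zero; suc; _≤_; _∸_)
open import Data.Fin using (Fin; toℕ)
open import Data.Product using (_×_; ∃)
open import Relation.Nullary using (¬_)
open import Relation.Binary.PropositionalEquality using (_≡_; _≢_)

Graph : ℕ → Set₁
Graph n = Fin n → Fin n → Set

complete : (t : ℕ) → Graph t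
complete t i j = i ≢ j

complement : ∀ {n} → Graph n → Graph n
complement G i j = (i ≢ j) × ¬ G i j

-- Wheel adjacency on labels 0 .. n-1: vertex 0 is the hub, adjacent to all
-- others; vertices 1 .. n-1 form the cycle 1 - 2 - ... - (n-1) - 1.
data WheelAdj (n : ℕ) : ℕ → ℕ → Set where
  hubˡ  : ∀ j → 1 ≤ j → WheelAdj n 0 j
  hubʳ  : ∀ j → 1 ≤ j → WheelAdj n j 0
  nextˡ : ∀ i → 1 ≤ i → suc i ≤ n ∸ 1 → WheelAdj n i (suc i)
  nextʳ : ∀ i → 1 ≤ i → suc i ≤ n ∸ 1 → WheelAdj n (suc i) i
  wrapˡ : WheelAdj n 1 (n ∸ 1)
  wrapʳ : WheelAdj n (n ∸ 1) 1

-- The wheel graph W_n = K_1 + C_{n-1} (meaningful for n ≥ 4).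
wheel : (n : ℕ) → Graph n
wheel n i j = WheelAdj n (toℕ i) (toℕ j)

data PathIn {n} (G : Graph n) (B : Fin n → Set) : Fin n → Fin n → Set where
  here : ∀ {u} → B u → PathIn G B u u
  step : ∀ {u w v} → B u → G u w → PathIn G B w v → PathIn G B u v

record MinorModel {m n} (H : Graph m) (G : Graph n) : Set₁ where
  field
    branch    : Fin m → Fin n → Set
    nonempty  : ∀ a → ∃ λ v → branch a v
    disjoint  : ∀ a b v → branch a v → branch b v → a ≡ b
    connected : ∀ a u v → branch a u → branch a v → PathIn G (branch a) u v
    edges     : ∀ a b → H a b →
                ∃ λ u → ∃ λ v → branch a u × branch b v × G u v

IsMinor : ∀ {m n} → Graph m → Graph n → Set₁
IsMinor H G = MinorModel H G

{-# OPTIONS --safe #-}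
-- The hub of W_n is isolated in the complement, so everything happens in the
-- complement of the cycle 1, …, m (m = n − 1), where two vertices are
-- adjacent iff they are not cyclically consecutive.  Take the even vertices
-- 2, 4, …, 2s as singleton branch sets and the pairs {2i+1, 2(p+i)+1},
-- i < p, of odd vertices; this fits when 2s ≤ m and 4p ≤ m + 1.  The two
-- vertices of a pair are 2p ≥ 4 apart, so each pair is connected, and an
-- even vertex is consecutive to at most one vertex of a pair, so all branch
-- sets are mutually adjacent: K_{s+p} is a minor.  For m ≥ 7 one can take
-- s + p ≥ ⌊3m/4⌋ (raising m by 4 raises s by 2 and p by 1); the cases
-- m = 5, 6 are small explicit models.
module Submission where

open import Defs
open import Data.Nat using (ℕ; _≤_; _*_; _∸_)
open import Data.Nat.DivMod using (_/_)

open import Data.Bool using (Bool; false; true)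
open import Data.Empty using (⊥-elim)
open import Data.Fin using (Fin; toℕ; fromℕ<; inject≤; splitAt)
open import Data.Fin.Patterns using (0F; 1F; 2F; 3F; 4F; 5F; 6F)
open import Data.Fin.Properties
  using (toℕ-injective; toℕ<n; fromℕ<-injective; fromℕ<-cong; toℕ-fromℕ<; inject≤-injective; +↔⊎)
open import Data.Nat using (zero; suc; _+_; _<_; z≤n; s≤s; _≟_)
open import Data.Nat.DivMod using (/-congˡ; +-distrib-/-∣ʳ)
open import Data.Nat.Divisibility using (divides-refl)
open import Data.Nat.Properties
open import Data.Product using (_,_; ∃; ∃₂)
open import Data.Sum as Sum using (_⊎_; inj₁; inj₂)
open import Function using (_∘_)
open import Function.Bundles using (Injection)
open import Function.Definitions using (Injective)
open import Function.Properties.Inverse using (Inverse⇒Injection)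
open import Relation.Binary.Definitions using (Symmetric)
open import Relation.Binary.PropositionalEquality
open import Relation.Nullary using (¬_; yes; no; contradiction)

-- Branch set a is {end a false, end a true}, a singleton when the two ends coincide.
record PairModel {n} (I : Set) (G : Graph n) : Set where
  field
    end      : I → Bool → Fin n
    disjoint : ∀ {a b x y} → end a x ≡ end b y → a ≡ b
    joined   : ∀ a → end a false ≡ end a true ⊎ G (end a false) (end a true)
    linked   : ∀ {a b} → a ≢ b → ∃₂ λ x y → G (end a x) (end b y)

disjoint-by-label : ∀ {n} {I : Set} (end : I → Bool → Fin n) (label : Fin n → I) →
                    (∀ a x → label (end a x) ≡ a) →
                    ∀ {a b x y} → end a x ≡ end b y → a ≡ b
disjoint-by-label end label label-end {a} {b} {x} {y} eq = begin
  a                ≡⟨ label-end a x ⟨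
  label (end a x)  ≡⟨ cong label eq ⟩
  label (end b y)  ≡⟨ label-end b y ⟩
  b                ∎
  where open ≡-Reasoning

pairModel-reindex : ∀ {n} {I J : Set} {G : Graph n} (ι : J → I) → Injective _≡_ _≡_ ι →
                    PairModel I G → PairModel J G
pairModel-reindex ι ι-injective P = record
  { end      = end ∘ ι
  ; disjoint = λ eq → ι-injective (disjoint eq)
  ; joined   = joined ∘ ι
  ; linked   = λ a≢b → linked (a≢b ∘ ι-injective)
  }
  where open PairModel P

pairModel⇒minor : ∀ {n t} {G : Graph n} → Symmetric G → PairModel (Fin t) G →
                  IsMinor (complete t) G
pairModel⇒minor {n} {t} {G} G-sym P = record
  { branch    = Branch
  ; nonempty  = λ a → end a false , false , refl
  ; disjoint  = λ a b v (x , ex) (y , ey) → disjoint (trans ex (sym ey))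
  ; connected = λ { a _ _ (x , refl) (y , refl) → walk a x y }
  ; edges     = λ a b a≢b → let x , y , adj = linked a≢b in
                              end a x , end b y , (x , refl) , (y , refl) , adj
  }
  where
  open PairModel P

  Branch : Fin t → Fin n → Set
  Branch a v = ∃ λ x → end a x ≡ v

  walk : ∀ a x y → PathIn G (Branch a) (end a x) (end a y)
  walk a false false = here (false , refl)
  walk a true  true  = here (true , refl)
  walk a false true with joined a
  ... | inj₁ same = subst (PathIn G (Branch a) (end a false)) same (here (false , refl))
  ... | inj₂ adj  = step (false , refl) adj (here (true , refl))
  walk a true false with joined a
  ... | inj₁ same = subst (λ u → PathIn G (Branch a) u (end a false)) same (here (false , refl))
  ... | inj₂ adj  = step (true , refl) (G-sym adj) (here (false , refl))

wheelAdj-sym : ∀ {n U V} → WheelAdj n U V → WheelAdj n V U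
wheelAdj-sym (hubˡ j 1≤j)        = hubʳ j 1≤j
wheelAdj-sym (hubʳ j 1≤j)        = hubˡ j 1≤j
wheelAdj-sym (nextˡ i 1≤i i<n-1) = nextʳ i 1≤i i<n-1
wheelAdj-sym (nextʳ i 1≤i i<n-1) = nextˡ i 1≤i i<n-1
wheelAdj-sym wrapˡ               = wrapʳ
wheelAdj-sym wrapʳ               = wrapˡ

complement-sym : ∀ {n} {G : Graph n} → Symmetric G → Symmetric (complement G)
complement-sym G-sym (u≢v , ¬uv) = (u≢v ∘ sym) , (¬uv ∘ G-sym)

complement-wheel-sym : ∀ {n} → Symmetric (complement (wheel n))
complement-wheel-sym = complement-sym wheelAdj-sym

-- Non-adjacency in the wheel, one field per constructor of WheelAdj; matching on
-- WheelAdj directly at indices such as double (suc A) gets stuck in unification.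
record Apart (n U V : ℕ) : Set where
  field
    distinct : U ≢ V
    notHubˡ  : U ≢ 0
    notHubʳ  : V ≢ 0
    notNextˡ : suc U ≢ V
    notNextʳ : suc V ≢ U
    notWrapˡ : U ≡ 1 → V ≢ n ∸ 1
    notWrapʳ : V ≡ 1 → U ≢ n ∸ 1

Apart-sym : ∀ {n U V} → Apart n U V → Apart n V U
Apart-sym a = record
  { distinct = distinct ∘ sym
  ; notHubˡ  = notHubʳ
  ; notHubʳ  = notHubˡ
  ; notNextˡ = notNextʳ
  ; notNextʳ = notNextˡ
  ; notWrapˡ = notWrapʳ
  ; notWrapʳ = notWrapˡ
  }
  where open Apart a

Apart⇒¬WheelAdj : ∀ {n U V} → Apart n U V → ¬ WheelAdj n U V
Apart⇒¬WheelAdj a (hubˡ _ _)    = Apart.notHubˡ a refl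
Apart⇒¬WheelAdj a (hubʳ _ _)    = Apart.notHubʳ a refl
Apart⇒¬WheelAdj a (nextˡ _ _ _) = Apart.notNextˡ a refl
Apart⇒¬WheelAdj a (nextʳ _ _ _) = Apart.notNextʳ a refl
Apart⇒¬WheelAdj a wrapˡ         = Apart.notWrapˡ a refl refl
Apart⇒¬WheelAdj a wrapʳ         = Apart.notWrapʳ a refl refl

Apart⇒complement : ∀ {n U V} .(U<n : U < n) .(V<n : V < n) → Apart n U V →
                   complement (wheel n) (fromℕ< U<n) (fromℕ< V<n)
Apart⇒complement {n} U<n V<n a =
  (λ eq → Apart.distinct a (fromℕ<-injective _ _ U<n V<n eq)) ,
  (λ adj → Apart⇒¬WheelAdj a (subst₂ (WheelAdj n) (toℕ-fromℕ< U<n) (toℕ-fromℕ< V<n) adj))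

double : ℕ → ℕ
double zero    = zero
double (suc k) = suc (suc (double k))

double-injective : ∀ {a b} → double a ≡ double b → a ≡ b
double-injective {zero}  {zero}  _  = refl
double-injective {suc a} {suc b} eq = cong suc (double-injective (suc-injective (suc-injective eq)))

double-mono-≤ : ∀ {a b} → a ≤ b → double a ≤ double b
double-mono-≤ z≤n       = z≤n
double-mono-≤ (s≤s a≤b) = s≤s (s≤s (double-mono-≤ a≤b))

odd≢double : ∀ a b → suc (double a) ≢ double b
odd≢double zero    (suc zero)    ()
odd≢double zero    (suc (suc b)) ()
odd≢double (suc a) (suc b)       eq = odd≢double a b (suc-injective (suc-injective eq))

apart-odd-odd : ∀ {m I J} → I ≢ J →
                (I ≡ 0 → suc (double J) ≢ m) → (J ≡ 0 → suc (double I) ≢ m) →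
                Apart (suc m) (suc (double I)) (suc (double J))
apart-odd-odd {I = I} {J} I≢J I-wrap J-wrap = record
  { distinct = I≢J ∘ double-injective ∘ suc-injective
  ; notHubˡ  = λ ()
  ; notHubʳ  = λ ()
  ; notNextˡ = odd≢double J (suc I) ∘ sym
  ; notNextʳ = odd≢double I (suc J) ∘ sym
  ; notWrapˡ = I-wrap ∘ double-injective ∘ suc-injective
  ; notWrapʳ = J-wrap ∘ double-injective ∘ suc-injective
  }

apart-even-even : ∀ {m A B} → A ≢ B → Apart (suc m) (double (suc A)) (double (suc B))
apart-even-even {A = A} {B} A≢B = record
  { distinct = A≢B ∘ suc-injective ∘ double-injective
  ; notHubˡ  = λ ()
  ; notHubʳ  = λ ()
  ; notNextˡ = odd≢double (suc A) (suc B)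
  ; notNextʳ = odd≢double (suc B) (suc A)
  ; notWrapˡ = λ ()
  ; notWrapʳ = λ ()
  }

apart-even-odd : ∀ {m A J} → J ≢ suc A → J ≢ A → (J ≡ 0 → double (suc A) ≢ m) →
                 Apart (suc m) (double (suc A)) (suc (double J))
apart-even-odd {A = A} {J} J≢1+A J≢A wrap = record
  { distinct = odd≢double J (suc A) ∘ sym
  ; notHubˡ  = λ ()
  ; notHubʳ  = λ ()
  ; notNextˡ = J≢1+A ∘ sym ∘ double-injective ∘ suc-injective
  ; notNextʳ = J≢A ∘ suc-injective ∘ double-injective
  ; notWrapˡ = λ ()
  ; notWrapʳ = wrap ∘ double-injective ∘ suc-injective
  }

-- s singletons and p = 2 + q pairs; the offset makes p ≥ 2 hold definitionally.
record Parameters (m : ℕ) : Set where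
  field
    s q       : ℕ
    evens-fit : double s ≤ m
    odds-fit  : double ((2 + q) + (2 + q)) ≤ suc m
    enough    : 3 * m / 4 ≤ s + (2 + q)

3[4+m]/4≡3m/4+3 : ∀ m → 3 * (4 + m) / 4 ≡ 3 * m / 4 + 3
3[4+m]/4≡3m/4+3 m = begin
  3 * (4 + m) / 4  ≡⟨ /-congˡ (trans (*-distribˡ-+ 3 4 m) (+-comm 12 (3 * m))) ⟩
  (3 * m + 12) / 4 ≡⟨ +-distrib-/-∣ʳ (3 * m) (divides-refl 3) ⟩
  3 * m / 4 + 3    ∎
  where open ≡-Reasoning

parameters : ∀ k → Parameters (7 + k)
parameters 0 = record { s = 3 ; q = 0 ; evens-fit = n≤1+n 6 ; odds-fit = ≤-refl ; enough = ≤-refl }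
parameters 1 = record { s = 4 ; q = 0 ; evens-fit = ≤-refl ; odds-fit = n≤1+n 8 ; enough = ≤-refl }
parameters 2 = record { s = 4 ; q = 0 ; evens-fit = n≤1+n 8 ; odds-fit = m≤n+m 8 2 ; enough = ≤-refl }
parameters 3 = record { s = 5 ; q = 0 ; evens-fit = ≤-refl ; odds-fit = m≤n+m 8 3 ; enough = ≤-refl }
parameters (suc (suc (suc (suc k)))) = record
  { s         = 2 + s
  ; q         = suc q
  ; evens-fit = s≤s (s≤s (s≤s (s≤s evens-fit)))
  ; odds-fit  = s≤s (s≤s (subst (_≤ suc (suc (suc (7 + k))))
                                 (cong double (sym (+-suc (2 + q) (2 + q))))
                                 (s≤s (s≤s odds-fit))))
  ; enough    = begin
      3 * (4 + (7 + k)) / 4   ≡⟨ 3[4+m]/4≡3m/4+3 (7 + k) ⟩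
      3 * (7 + k) / 4 + 3     ≤⟨ +-monoˡ-≤ 3 enough ⟩
      s + (2 + q) + 3         ≡⟨ +-comm (s + (2 + q)) 3 ⟩
      3 + (s + (2 + q))       ≡⟨ cong (suc ∘ suc) (sym (+-suc s (2 + q))) ⟩
      (2 + s) + (2 + suc q)   ∎
  }
  where open Parameters (parameters k)
        open ≤-Reasoning

module ParityConstruction {m} (P : Parameters m) where
  open Parameters P

  p : ℕ
  p = 2 + q

  pair-vertex : ℕ → Bool → ℕ
  pair-vertex J false = suc (double J)
  pair-vertex J true  = suc (double (p + J))

  vertex : Fin s ⊎ Fin p → Bool → ℕ
  vertex (inj₁ a) _ = double (suc (toℕ a))
  vertex (inj₂ i) b = pair-vertex (toℕ i) b

  vertex≤m : ∀ x b → vertex x b ≤ m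
  vertex≤m (inj₁ a) _     = ≤-trans (double-mono-≤ (toℕ<n a)) evens-fit
  vertex≤m (inj₂ i) false = ≤-trans (s≤s (double-mono-≤ (m≤n+m (toℕ i) p))) (vertex≤m (inj₂ i) true)
  vertex≤m (inj₂ i) true  = ≤-pred (≤-trans (double-mono-≤ (+-monoʳ-< p (toℕ<n i))) odds-fit)

  vertex-disjoint : ∀ {x y b c} → vertex x b ≡ vertex y c → x ≡ y
  vertex-disjoint {inj₁ a} {inj₁ b}                 eq =
    cong inj₁ (toℕ-injective (suc-injective (double-injective eq)))
  vertex-disjoint {inj₁ a} {inj₂ j} {c = false}     eq = ⊥-elim (odd≢double _ _ (sym eq))
  vertex-disjoint {inj₁ a} {inj₂ j} {c = true}      eq = ⊥-elim (odd≢double _ _ (sym eq))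
  vertex-disjoint {inj₂ i} {inj₁ b} {false}         eq = ⊥-elim (odd≢double _ _ eq)
  vertex-disjoint {inj₂ i} {inj₁ b} {true}          eq = ⊥-elim (odd≢double _ _ eq)
  vertex-disjoint {inj₂ i} {inj₂ j} {false} {false} eq =
    cong inj₂ (toℕ-injective (double-injective (suc-injective eq)))
  vertex-disjoint {inj₂ i} {inj₂ j} {false} {true}  eq =
    ⊥-elim (<⇒≢ (<-≤-trans (toℕ<n i) (m≤m+n p _)) (double-injective (suc-injective eq)))
  vertex-disjoint {inj₂ i} {inj₂ j} {true}  {false} eq =
    ⊥-elim (<⇒≢ (<-≤-trans (toℕ<n j) (m≤m+n p _)) (double-injective (suc-injective (sym eq))))
  vertex-disjoint {inj₂ i} {inj₂ j} {true}  {true}  eq =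
    cong inj₂ (toℕ-injective (+-cancelˡ-≡ p _ _ (double-injective (suc-injective eq))))

  -- Since p ≥ 2, the last cycle vertex m ≥ 4p − 1 lies beyond 2p + 2.
  below-last : ∀ {V} → V ≤ double (suc p) → V ≢ m
  below-last V≤ = <⇒≢ (≤-pred (≤-trans (s≤s (s≤s V≤)) (≤-trans (double-mono-≤ 2+p≤p+p) odds-fit)))
    where
    2+p≤p+p : 2 + p ≤ p + p
    2+p≤p+p = +-monoˡ-≤ p (s≤s (s≤s z≤n))

  pair-apart : ∀ I → Apart (suc m) (suc (double I)) (suc (double (p + I)))
  pair-apart I = apart-odd-odd (m≢1+n+m I) wrap (λ ())
    where
    wrap : I ≡ 0 → suc (double (p + I)) ≢ m
    wrap refl = below-last (s≤s (≤-trans (≤-reflexive (cong double (+-identityʳ p))) (n≤1+n _)))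

  near-apart : ∀ {A J} → J < A → A ≤ p + J → Apart (suc m) (double (suc A)) (suc (double J))
  near-apart {A} {J} J<A A≤p+J = apart-even-odd (<⇒≢ (m<n⇒m<1+n J<A)) (<⇒≢ J<A) wrap
    where
    wrap : J ≡ 0 → double (suc A) ≢ m
    wrap refl = below-last (double-mono-≤ (s≤s (subst (A ≤_) (+-identityʳ p) A≤p+J)))

  -- If the far end 2(p+J)+1 is consecutive to 2(A+1), then J < A ≤ p + J and the near end is not.
  single-pair-apart : ∀ A J → ∃ λ c → Apart (suc m) (double (suc A)) (pair-vertex J c)
  single-pair-apart A J with p + J ≟ suc A | p + J ≟ A
  ... | no p+J≢1+A | no p+J≢A = true , apart-even-odd p+J≢1+A p+J≢A (λ ())
  ... | yes p+J≡1+A | _ =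
    false , near-apart (subst (J <_) (suc-injective p+J≡1+A) (s≤s (m≤n+m J q)))
                       (subst (A ≤_) (sym p+J≡1+A) (n≤1+n A))
  ... | no _ | yes p+J≡A =
    false , near-apart (subst (J <_) p+J≡A (m<n+m J (s≤s z≤n))) (≤-reflexive (sym p+J≡A))

  joined : ∀ x → vertex x false ≡ vertex x true ⊎ Apart (suc m) (vertex x false) (vertex x true)
  joined (inj₁ a) = inj₁ refl
  joined (inj₂ i) = inj₂ (pair-apart (toℕ i))

  linked : ∀ {x y} → x ≢ y → ∃₂ λ b c → Apart (suc m) (vertex x b) (vertex y c)
  linked {inj₁ a} {inj₁ b} a≢b =
    false , false , apart-even-even (a≢b ∘ cong inj₁ ∘ toℕ-injective)
  linked {inj₂ i} {inj₂ j} i≢j =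
    true , true , apart-odd-odd (i≢j ∘ cong inj₂ ∘ toℕ-injective ∘ +-cancelˡ-≡ p _ _) (λ ()) (λ ())
  linked {inj₁ a} {inj₂ j} _ = let c , apart = single-pair-apart (toℕ a) (toℕ j) in false , c , apart
  linked {inj₂ i} {inj₁ b} _ = let c , apart = single-pair-apart (toℕ b) (toℕ i) in c , false , Apart-sym apart

  parity-pairs : PairModel (Fin s ⊎ Fin p) (complement (wheel (suc m)))
  parity-pairs = record
    { end      = λ x b → fromℕ< (s≤s (vertex≤m x b))
    ; disjoint = λ eq → vertex-disjoint (fromℕ<-injective _ _ _ _ eq)
    ; joined   = λ x → Sum.map (λ eq → fromℕ<-cong _ _ eq _ _) (Apart⇒complement _ _) (joined x)
    ; linked   = λ x≢y → let b , c , apart = linked x≢y in b , c , Apart⇒complement _ _ apart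
    }

  parity-minor : IsMinor (complete (3 * m / 4)) (complement (wheel (suc m)))
  parity-minor = pairModel⇒minor complement-wheel-sym (pairModel-reindex ι ι-injective parity-pairs)
    where
    ι : Fin (3 * m / 4) → Fin s ⊎ Fin p
    ι a = splitAt s (inject≤ a enough)

    ι-injective : Injective _≡_ _≡_ ι
    ι-injective eq = inject≤-injective enough enough _ _ (Injection.injective (Inverse⇒Injection +↔⊎) eq)

wheel₆-pairs : PairModel (Fin 3) (complement (wheel 6))
wheel₆-pairs = record
  { end      = end
  ; disjoint = disjoint-by-label end label label-end
  ; joined   = joined
  ; linked   = linked
  }
  where
  end : Fin 3 → Bool → Fin 6
  end 0F _     = 1F
  end 1F false = 3F
  end 1F true  = 5F
  end 2F false = 2F
  end 2F true  = 4F

  label : Fin 6 → Fin 3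
  label 3F = 1F
  label 5F = 1F
  label 2F = 2F
  label 4F = 2F
  label _  = 0F

  label-end : ∀ a x → label (end a x) ≡ a
  label-end 0F _     = refl
  label-end 1F false = refl
  label-end 1F true  = refl
  label-end 2F false = refl
  label-end 2F true  = refl

  joined : ∀ a → end a false ≡ end a true ⊎ complement (wheel 6) (end a false) (end a true)
  joined 0F = inj₁ refl
  joined 1F = inj₂ ((λ ()) , (λ ()))
  joined 2F = inj₂ ((λ ()) , (λ ()))

  linked : ∀ {a b} → a ≢ b → ∃₂ λ x y → complement (wheel 6) (end a x) (end b y)
  linked {0F} {0F} 0≢0 = contradiction refl 0≢0
  linked {1F} {1F} 1≢1 = contradiction refl 1≢1
  linked {2F} {2F} 2≢2 = contradiction refl 2≢2
  linked {0F} {1F} _   = false , false , (λ ()) , (λ ())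
  linked {1F} {0F} _   = false , false , (λ ()) , (λ ())
  linked {0F} {2F} _   = false , true  , (λ ()) , (λ ())
  linked {2F} {0F} _   = true  , false , (λ ()) , (λ ())
  linked {1F} {2F} _   = true  , false , (λ ()) , (λ ())
  linked {2F} {1F} _   = false , true  , (λ ()) , (λ ())

wheel₇-pairs : PairModel (Fin 4) (complement (wheel 7))
wheel₇-pairs = record
  { end      = end
  ; disjoint = disjoint-by-label end label label-end
  ; joined   = joined
  ; linked   = linked
  }
  where
  end : Fin 4 → Bool → Fin 7
  end 0F _     = 1F
  end 1F _     = 4F
  end 2F false = 2F
  end 2F true  = 5F
  end 3F false = 3F
  end 3F true  = 6F

  label : Fin 7 → Fin 4
  label 4F = 1F
  label 2F = 2F
  label 5F = 2F
  label 3F = 3F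
  label 6F = 3F
  label _  = 0F

  label-end : ∀ a x → label (end a x) ≡ a
  label-end 0F _     = refl
  label-end 1F _     = refl
  label-end 2F false = refl
  label-end 2F true  = refl
  label-end 3F false = refl
  label-end 3F true  = refl

  joined : ∀ a → end a false ≡ end a true ⊎ complement (wheel 7) (end a false) (end a true)
  joined 0F = inj₁ refl
  joined 1F = inj₁ refl
  joined 2F = inj₂ ((λ ()) , (λ ()))
  joined 3F = inj₂ ((λ ()) , (λ ()))

  linked : ∀ {a b} → a ≢ b → ∃₂ λ x y → complement (wheel 7) (end a x) (end b y)
  linked {0F} {0F} 0≢0 = contradiction refl 0≢0
  linked {1F} {1F} 1≢1 = contradiction refl 1≢1
  linked {2F} {2F} 2≢2 = contradiction refl 2≢2
  linked {3F} {3F} 3≢3 = contradiction refl 3≢3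
  linked {0F} {1F} _   = false , false , (λ ()) , (λ ())
  linked {1F} {0F} _   = false , false , (λ ()) , (λ ())
  linked {0F} {2F} _   = false , true  , (λ ()) , (λ ())
  linked {2F} {0F} _   = true  , false , (λ ()) , (λ ())
  linked {0F} {3F} _   = false , false , (λ ()) , (λ ())
  linked {3F} {0F} _   = false , false , (λ ()) , (λ ())
  linked {1F} {2F} _   = false , false , (λ ()) , (λ ())
  linked {2F} {1F} _   = false , false , (λ ()) , (λ ())
  linked {1F} {3F} _   = false , true  , (λ ()) , (λ ())
  linked {3F} {1F} _   = true  , false , (λ ()) , (λ ())
  linked {2F} {3F} _   = false , true  , (λ ()) , (λ ())
  linked {3F} {2F} _   = true  , false , (λ ()) , (λ ())

complement-wheel-minor : ∀ k → IsMinor (complete (3 * (5 + k) / 4)) (complement (wheel (6 + k)))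
complement-wheel-minor 0             = pairModel⇒minor complement-wheel-sym wheel₆-pairs
complement-wheel-minor 1             = pairModel⇒minor complement-wheel-sym wheel₇-pairs
complement-wheel-minor (suc (suc k)) = ParityConstruction.parity-minor (parameters k)

theorem3 : (n : ℕ) → 6 ≤ n →
    IsMinor (complete ((3 * (n ∸ 1)) / 4)) (complement (wheel n))
theorem3 n 6≤n =
  subst (λ n → IsMinor (complete ((3 * (n ∸ 1)) / 4)) (complement (wheel n)))
        (m+[n∸m]≡n 6≤n)
        (complement-wheel-minor (n ∸ 6))
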